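{- Let $d\geq 7$ and let $G$ be a $d$-regular graph with girth $g(G)=5$. If there exists a vertex of $G$ that lies on no cycle of length $6$ in $G$, then $\chi_b(G)=d+1$.
   Context: All graphs are simple, finite and undirected; the girth is the length of a shortest cycle. A proper $k$-coloring $c:V(G)\to\{1,\dots,k\}$ is a b-coloring if for every color $i\in\{1,\dots,k\}$ there is a vertex $v$ with $c(v)=i$ such that all $k$ colors appear on the closed neighborhood $N[v]$. The b-chromatic number $\chi_b(G)$ is the largest $k$ for which $G$ admits a b-coloring with $k$ colors. -}

module Defs where

open import Data.Nat using (ℕ; zero; suc; _≤_; _<_)
open import Data.Fin using (Fin; zero; suc; inject₁; fromℕ)
open import Data.Bool using (Bool; true; false; T)
open import Data.List using (List; length; filter)
open import Data.List.Base using ()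
open import Data.Fin.Base using ()
open import Data.List using (allFin)
open import Data.Bool using (T?)
open import Data.Product using (Σ; ∃; _×_; _,_)
open import Data.Sum using (_⊎_)
open import Relation.Nullary using (¬_)
open import Relation.Binary.PropositionalEquality using (_≡_; _≢_)
open import Function.Definitions using (Injective)
open import Data.Empty using (⊥)

record Graph : Set where
  field
    n     : ℕ
    adj   : Fin n → Fin n → Bool
    sym   : ∀ u v → adj u v ≡ adj v u
    irrefl : ∀ v → adj v v ≡ false
open Graph public

Vertex : Graph → Set
Vertex G = Fin (n G)

Adj : (G : Graph) → Vertex G → Vertex G → Set
Adj G u v = T (adj G u v)

degree : (G : Graph) → Vertex G → ℕ
degree G v = length (filter (λ u → T? (adj G v u)) (allFin (n G)))

Regular : ℕ → Graph → Set
Regular d G = ∀ v → degree G v ≡ d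

-- A cycle of length (suc m) is an injective map c : Fin (suc m) → V
-- with c i ~ c (i+1) for consecutive indices and c m ~ c 0 (closing edge);
-- cycles must have length ≥ 3.
IsCycle : (G : Graph) (m : ℕ) → (Fin (suc m) → Vertex G) → Set
IsCycle G m c =
  (2 ≤ m) ×
  Injective _≡_ _≡_ c ×
  (∀ (i : Fin m) → Adj G (c (inject₁ i)) (c (suc i))) ×
  Adj G (c (fromℕ m)) (c zero)

HasCycle : Graph → ℕ → Set
HasCycle G zero = ⊥
HasCycle G (suc m) = Σ (Fin (suc m) → Vertex G) (IsCycle G m)

OnCycle : (G : Graph) → Vertex G → ℕ → Set
OnCycle G v zero = ⊥
OnCycle G v (suc m) =
  Σ (Fin (suc m) → Vertex G) λ c → IsCycle G m c × ∃ λ i → c i ≡ v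

Girth : Graph → ℕ → Set
Girth G g = HasCycle G g × (∀ k → k < g → ¬ HasCycle G k)

Proper : (G : Graph) (k : ℕ) → (Vertex G → Fin k) → Set
Proper G k c = ∀ u v → Adj G u v → c u ≢ c v

Dominant : (G : Graph) (k : ℕ) → (Vertex G → Fin k) → Vertex G → Set
Dominant G k c v = ∀ (j : Fin k) → (c v ≡ j) ⊎ (∃ λ u → Adj G v u × c u ≡ j)

IsBColoring : (G : Graph) (k : ℕ) → (Vertex G → Fin k) → Set
IsBColoring G k c =
  Proper G k c × (∀ (i : Fin k) → ∃ λ v → c v ≡ i × Dominant G k c v)

HasBColoring : Graph → ℕ → Set
HasBColoring G k = Σ (Vertex G → Fin k) (IsBColoring G k)

BChromatic : Graph → ℕ → Set
BChromatic G k = HasBColoring G k × (∀ k' → HasBColoring G k' → k' ≤ k)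

-- Colour v with 0 and its neighbours first i with suc i; v and every first i are to be the
-- b-vertices. Since first i already sees 0 and suc i, its d - 1 further neighbours must get
-- exactly the remaining colours, i.e. a bijection onto them. Girth 5 makes all these second
-- neighbours distinct and leaves only edges between second neighbours of different first i,
-- and because v lies on no 6-cycle these edges form a matching. The bijections are chosen one
-- group at a time: every second neighbour then has at most one forbidden colour, and a
-- permutation avoiding one forbidden value per position exists unless all forbidden values
-- agree, which would need d - 1 matched partners in the d - 2 admissible other groups. The
-- partial colouring extends greedily to all of G with d + 1 colours, and d + 1 is also an upper
-- bound because a b-vertex sees all colours on its d + 1 closed neighbours.
module Submission where

open import Defs hiding (sym)
open import Data.Bool using (T; T?)
open import Data.Empty using (⊥; ⊥-elim)
open import Data.Fin using (Fin; zero; suc; punchIn; punchOut; _≟_)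
open import Data.Fin.Patterns using (0F; 1F; 2F; 3F; 4F)
open import Data.Fin.Permutation using (Permutation′; _⟨$⟩ʳ_; _⟨$⟩ˡ_; transpose; _∘ₚ_; id; inverseʳ)
open import Data.Fin.Properties
  using ( suc-injective; punchInᵢ≢i; punchIn-injective; punchOut-injective; punchIn-punchOut
        ; punchOut-cong; punchOut-punchIn; injective⇒≤; any?; ¬∀⟶∃¬)
open import Data.List using (List; []; _∷_; lookup; filter; allFin)
open import Data.List.Membership.Propositional using (_∈_)
open import Data.List.Membership.Propositional.Properties using (∈-lookup; ∈-allFin; ∈-filter⁺; ∈-filter⁻)
open import Data.List.Relation.Unary.All as All using (All; []; _∷_)
open import Data.List.Relation.Unary.AllPairs using ([]; _∷_)
open import Data.List.Relation.Unary.Any as Any using (index)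
open import Data.List.Relation.Unary.Any.Properties using (lookup-index)
open import Data.List.Relation.Unary.Unique.Propositional using (Unique)
open import Data.List.Relation.Unary.Unique.Propositional.Properties using (allFin⁺; filter⁺)
open import Data.Maybe using (Maybe; just; nothing)
open import Data.Maybe.Properties using (just-injective; ≡-dec)
open import Data.Nat using (ℕ; zero; suc; _≤_; _<_; z≤n; s≤s)
open import Data.Nat.Properties using (1+n≰n)
open import Data.Product using (Σ; ∃; ∃₂; _×_; _,_; proj₁; proj₂)
open import Data.Sum using (_⊎_; inj₁; inj₂)
open import Data.Vec.Functional using (updateAt)
open import Data.Vec.Functional.Properties using (updateAt-updates; updateAt-minimal)
open import Function using (_∘_)
open import Function.Bundles using (Injection)
open import Function.Definitions using (Injective)
open import Function.Properties.Inverse using (↔⇒↣)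
open import Relation.Nullary using (¬_; Dec; yes; no)
open import Relation.Nullary.Decidable using (dec-true; dec-false)
open import Relation.Binary.PropositionalEquality using (_≡_; _≢_; refl; sym; trans; cong; subst; module ≡-Reasoning)

lookup-injective : ∀ {A : Set} {xs : List A} → Unique xs → Injective _≡_ _≡_ (lookup xs)
lookup-injective (_ ∷ _) {zero} {zero} _ = refl
lookup-injective (x∉xs ∷ _) {zero} {suc j} eq = ⊥-elim (All.lookup x∉xs (∈-lookup j) eq)
lookup-injective (x∉xs ∷ _) {suc i} {zero} eq = ⊥-elim (All.lookup x∉xs (∈-lookup i) (sym eq))
lookup-injective (_ ∷ xs-unique) {suc i} {suc j} eq = cong suc (lookup-injective xs-unique eq)

missed-value : ∀ {d} (f : Fin d → Maybe (Fin (suc d))) → ∃ λ x → ∀ t → f t ≢ just x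
missed-value {d} f with ¬∀⟶∃¬ (suc d) _ (λ x → any? λ t → ≡-dec _≟_ (f t) (just x)) not-onto
  where
  not-onto : ¬ (∀ x → ∃ λ t → f t ≡ just x)
  not-onto hit = 1+n≰n (injective⇒≤ {f = proj₁ ∘ hit} λ {x} {y} eq →
    just-injective (trans (sym (proj₂ (hit x))) (trans (cong f eq) (proj₂ (hit y)))))
... | x , unhit = x , λ t eq → unhit (t , eq)

no-injection-missing-two : ∀ {m} {g : Fin m → Fin (suc m)} → Injective _≡_ _≡_ g →
  ∀ {x y} → x ≢ y → (∀ a → g a ≢ x) → (∀ a → g a ≢ y) → ⊥
no-injection-missing-two {zero} _ {zero} {zero} x≢y _ _ = x≢y refl
no-injection-missing-two {suc m} {g} g-injective {x} {y} x≢y g≢x g≢y = 1+n≰n (injective⇒≤ {f = h} h-injective)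
  where
  x≢g : ∀ a → x ≢ g a
  x≢g a = g≢x a ∘ sym
  y′ : Fin (suc m)
  y′ = punchOut x≢y
  y′≢g′ : ∀ a → y′ ≢ punchOut (x≢g a)
  y′≢g′ a eq = g≢y a (sym (punchOut-injective x≢y (x≢g a) eq))
  h : Fin (suc m) → Fin m
  h a = punchOut (y′≢g′ a)
  h-injective : Injective _≡_ _≡_ h
  h-injective {a} {b} eq =
    g-injective (punchOut-injective (x≢g a) (x≢g b) (punchOut-injective (y′≢g′ a) (y′≢g′ b) eq))

punchOut? : ∀ {m} → Fin (suc m) → Fin (suc m) → Maybe (Fin m)
punchOut? i p with i ≟ p
... | yes _ = nothing
... | no i≢p = just (punchOut i≢p)

punchOut?-avoids : ∀ {m} {i p : Fin (suc m)} {x} → punchOut? i p ≢ just x → punchIn i x ≢ p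
punchOut?-avoids {i = i} {p} {x} out≢x with i ≟ p
... | yes refl = punchInᵢ≢i i x
... | no i≢p = λ eq → out≢x (cong just (trans (punchOut-cong i (sym eq)) (punchOut-punchIn i)))

punchOut?-just : ∀ {m} {i p : Fin (suc m)} {x} → punchOut? i p ≡ just x → p ≡ punchIn i x
punchOut?-just {i = i} {p} with i ≟ p
punchOut?-just | no i≢p = λ { refl → sym (punchIn-punchOut i≢p) }

permute-injective : ∀ {m} (π : Permutation′ m) → Injective _≡_ _≡_ (π ⟨$⟩ʳ_)
permute-injective π = Injection.injective (↔⇒↣ π)

transpose-matchˡ : ∀ {m} (i j : Fin m) → transpose i j ⟨$⟩ʳ i ≡ j
transpose-matchˡ i j rewrite dec-true (i ≟ i) refl = refl

transpose-matchʳ : ∀ {m} (i j : Fin m) → transpose i j ⟨$⟩ʳ j ≡ i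
transpose-matchʳ i j with j ≟ i
... | yes refl = refl
... | no _ rewrite dec-true (j ≟ j) refl = refl

transpose-other : ∀ {m} {i j k : Fin m} → k ≢ i → k ≢ j → transpose i j ⟨$⟩ʳ k ≡ k
transpose-other {i = i} {j} {k} k≢i k≢j rewrite dec-false (k ≟ i) k≢i | dec-false (k ≟ j) k≢j = refl

-- Repair the positions one at a time; a bad position a₀ is swapped with a position b whose
-- forbidden value is not π a₀, which exists because f is not constant.
avoiding-permutation : ∀ {m} (f : Fin m → Maybe (Fin m)) → (∀ c → ¬ (∀ a → f a ≡ just c)) →
  Σ (Permutation′ m) λ π → ∀ a → f a ≢ just (π ⟨$⟩ʳ a)
avoiding-permutation {m} f nonconstant with avoid-all (allFin m)
  where
  Avoids : Permutation′ m → Fin m → Set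
  Avoids π a = f a ≢ just (π ⟨$⟩ʳ a)

  escape : ∀ c → ∃ λ b → f b ≢ just c
  escape c = ¬∀⟶∃¬ m _ (λ b → ≡-dec _≟_ (f b) (just c)) (nonconstant c)

  repair : ∀ π a₀ → Σ (Permutation′ m) λ π′ → Avoids π′ a₀ × (∀ {a} → Avoids π a → Avoids π′ a)
  repair π a₀ with ≡-dec _≟_ (f a₀) (just (π ⟨$⟩ʳ a₀))
  ... | no ok = π , ok , λ ok′ → ok′
  ... | yes bad = transpose a₀ b ∘ₚ π , fixed , kept
    where
    b : Fin m
    b = proj₁ (escape (π ⟨$⟩ʳ a₀))
    fb≢πa₀ : f b ≢ just (π ⟨$⟩ʳ a₀)
    fb≢πa₀ = proj₂ (escape (π ⟨$⟩ʳ a₀))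
    via-transpose : ∀ {a c} → transpose a₀ b ⟨$⟩ʳ a ≡ c →
      f a ≡ just ((transpose a₀ b ∘ₚ π) ⟨$⟩ʳ a) → f a ≡ just (π ⟨$⟩ʳ c)
    via-transpose eq-c eq = trans eq (cong (just ∘ (π ⟨$⟩ʳ_)) eq-c)
    fixed : Avoids (transpose a₀ b ∘ₚ π) a₀
    fixed eq = fb≢πa₀ (subst (λ z → f z ≡ just (π ⟨$⟩ʳ a₀)) a₀≡b bad)
      where
      a₀≡b : a₀ ≡ b
      a₀≡b = permute-injective π (just-injective (trans (sym bad) (via-transpose (transpose-matchˡ a₀ b) eq)))
    kept : ∀ {a} → Avoids π a → Avoids (transpose a₀ b ∘ₚ π) a
    kept {a} ok = by-cases (a ≟ a₀) (a ≟ b)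
      where
      by-cases : Dec (a ≡ a₀) → Dec (a ≡ b) → Avoids (transpose a₀ b ∘ₚ π) a
      by-cases (yes refl) _ = ⊥-elim (ok bad)
      by-cases (no _) (yes refl) = fb≢πa₀ ∘ via-transpose (transpose-matchʳ a₀ a)
      by-cases (no a≢a₀) (no a≢b) = ok ∘ via-transpose (transpose-other a≢a₀ a≢b)

  avoid-all : ∀ as → Σ (Permutation′ m) λ π → All (Avoids π) as
  avoid-all [] = id , []
  avoid-all (a ∷ as) with avoid-all as
  ... | π , ok with repair π a
  ... | π′ , ok-a , keep = π′ , ok-a ∷ All.map keep ok
... | π , avoids = π , λ a → All.lookup avoids (∈-allFin a)

Slot : ℕ → Set
Slot e = Fin (suc e) × Fin e

module SlotColouring {e : ℕ} (_∼_ : Slot e → Slot e → Set) (_∼?_ : ∀ s t → Dec (s ∼ t))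
  (∼-sym : ∀ {s t} → s ∼ t → t ∼ s)
  (∼-across : ∀ {i j a b} → (i , a) ∼ (j , b) → i ≢ j)
  (∼-functional : ∀ {s t u} → s ∼ u → t ∼ u → s ≡ t) where

  Assignment : Set
  Assignment = Fin (suc e) → Permutation′ e

  colour : Assignment → Slot e → Fin (suc e)
  colour σ (i , a) = punchIn i (σ i ⟨$⟩ʳ a)

  colour≢group : ∀ σ i a → colour σ (i , a) ≢ i
  colour≢group σ i a = punchInᵢ≢i i (σ i ⟨$⟩ʳ a)

  colour-injective : ∀ σ i {a b} → colour σ (i , a) ≡ colour σ (i , b) → a ≡ b
  colour-injective σ i = permute-injective (σ i) ∘ punchIn-injective i _ _

  partner? : ∀ s → Dec (∃₂ λ j b → s ∼ (j , b))
  partner? s = any? λ j → any? λ b → s ∼? (j , b)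

  forbidden : Assignment → Fin (suc e) → Fin e → Maybe (Fin e)
  forbidden σ i a with partner? (i , a)
  ... | yes (j , b , _) = punchOut? i (colour σ (j , b))
  ... | no _ = nothing

  forbidden-sound : ∀ σ i a {x t} → forbidden σ i a ≢ just x → (i , a) ∼ t → punchIn i x ≢ colour σ t
  forbidden-sound σ i a {t = j , b} allowed r with partner? (i , a)
  ... | no none = ⊥-elim (none (j , b , r))
  ... | yes (j′ , b′ , r′) with ∼-functional (∼-sym r) (∼-sym r′)
  ...   | refl = punchOut?-avoids allowed

  forbidden-witness : ∀ σ i a {c} → forbidden σ i a ≡ just c →
    ∃ λ t → (i , a) ∼ t × colour σ t ≡ punchIn i c
  forbidden-witness σ i a eq with partner? (i , a)
  ... | yes (j , b , r) = (j , b) , r , punchOut?-just eq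

  -- If every slot of group i had forbidden value c, the groups of their partners would give an
  -- injection of Fin e into the e - 1 groups other than i and punchIn i c.
  forbidden-nonconstant : ∀ σ i c → ¬ (∀ a → forbidden σ i a ≡ just c)
  forbidden-nonconstant σ i c everywhere =
    no-injection-missing-two group-injective (punchInᵢ≢i i c ∘ sym) group≢i group≢C
    where
    witness : ∀ a → ∃ λ t → (i , a) ∼ t × colour σ t ≡ punchIn i c
    witness a = forbidden-witness σ i a (everywhere a)
    group : Fin e → Fin (suc e)
    group a = proj₁ (proj₁ (witness a))
    group≢i : ∀ a → group a ≢ i
    group≢i a = ∼-across (proj₁ (proj₂ (witness a))) ∘ sym
    group≢C : ∀ a → group a ≢ punchIn i c
    group≢C a eq = colour≢group σ _ _ (trans (proj₂ (proj₂ (witness a))) (sym eq))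
    group-injective : Injective _≡_ _≡_ group
    group-injective {a} {a′} eq with witness a | witness a′
    group-injective refl | (j , b) , r , cb | (j , b′) , r′ , cb′
      with colour-injective σ j (trans cb (sym cb′))
    ... | refl = cong proj₂ (∼-functional r r′)

  recolour-group : ∀ σ i → ∃ λ π → ∀ a {t} → (i , a) ∼ t → punchIn i (π ⟨$⟩ʳ a) ≢ colour σ t
  recolour-group σ i with avoiding-permutation (forbidden σ i) (forbidden-nonconstant σ i)
  ... | π , avoids = π , λ a → forbidden-sound σ i a (avoids a)

  ProperOn : List (Fin (suc e)) → Assignment → Set
  ProperOn is σ = ∀ {s t} → proj₁ s ∈ is → proj₁ t ∈ is → s ∼ t → colour σ s ≢ colour σ t

  proper-on : ∀ is → Σ Assignment (ProperOn is)
  proper-on [] = (λ _ → id) , λ ()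
  proper-on (i ∷ is) with proper-on is
  ... | σ , proper with recolour-group σ i
  ... | π , avoids = σ′ , proper′
    where
    σ′ : Assignment
    σ′ = updateAt σ i (λ _ → π)
    updated : ∀ a → colour σ′ (i , a) ≡ punchIn i (π ⟨$⟩ʳ a)
    updated a = cong (λ ρ → punchIn i (ρ ⟨$⟩ʳ a)) (updateAt-updates i σ)
    unchanged : ∀ {j} b → j ≢ i → colour σ′ (j , b) ≡ colour σ (j , b)
    unchanged {j} b j≢i = cong (λ ρ → punchIn j (ρ ⟨$⟩ʳ b)) (updateAt-minimal j i σ j≢i)
    proper′ : ProperOn (i ∷ is) σ′
    proper′ {j , a} {k , b} j∈ k∈ r with j ≟ i | k ≟ i
    ... | yes refl | yes refl = λ _ → ∼-across r refl
    ... | yes refl | no k≢i = λ eq → avoids a r (trans (sym (updated a)) (trans eq (unchanged b k≢i)))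
    ... | no j≢i | yes refl = λ eq → avoids b (∼-sym r) (trans (sym (updated b)) (trans (sym eq) (unchanged a j≢i)))
    ... | no j≢i | no k≢i = λ eq →
      proper (Any.tail j≢i j∈) (Any.tail k≢i k∈) r (trans (sym (unchanged a j≢i)) (trans eq (unchanged b k≢i)))

  slot-colouring : Σ Assignment λ σ → ∀ {s t} → s ∼ t → colour σ s ≢ colour σ t
  slot-colouring with proper-on (allFin (suc e))
  ... | σ , proper = σ , proper (∈-allFin _) (∈-allFin _)

module GraphColouring (G : Graph) where

  adj⇒≢ : ∀ {u w} → Adj G u w → u ≢ w
  adj⇒≢ {u} u~w refl = subst T (irrefl G u) u~w

  adj-sym : ∀ {u w} → Adj G u w → Adj G w u
  adj-sym {u} {w} = subst T (Graph.sym G u w)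

  record Neighbours (x : Vertex G) (d : ℕ) : Set where
    field
      nbr : Fin d → Vertex G
      nbr-adj : ∀ t → Adj G x (nbr t)
      nbr-injective : Injective _≡_ _≡_ nbr
      nbr-surjective : ∀ {u} → Adj G x u → ∃ λ t → nbr t ≡ u

  open Neighbours public

  neighbours : ∀ {d} x → degree G x ≡ d → Neighbours x d
  neighbours x refl = record
    { nbr = lookup xs
    ; nbr-adj = λ t → proj₂ (∈-filter⁻ adjacent? {xs = allFin (n G)} (∈-lookup t))
    ; nbr-injective = lookup-injective (filter⁺ adjacent? (allFin⁺ (n G)))
    ; nbr-surjective = λ x~u →
        let u∈xs = ∈-filter⁺ adjacent? (∈-allFin _) x~u in index u∈xs , sym (lookup-index u∈xs)
    }
    where
    adjacent? : ∀ u → Dec (Adj G x u)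
    adjacent? u = T? (adj G x u)
    xs : List (Vertex G)
    xs = filter adjacent? (allFin (n G))

  PartialColouring : ℕ → Set
  PartialColouring k = Vertex G → Maybe (Fin k)

  ProperPartial : ∀ {k} → PartialColouring k → Set
  ProperPartial p = ∀ {u w x} → Adj G u w → p u ≡ just x → p w ≢ just x

  _⊑_ : ∀ {k} → PartialColouring k → PartialColouring k → Set
  p ⊑ q = ∀ {u x} → p u ≡ just x → q u ≡ just x

  Coloured : ∀ {k} → PartialColouring k → Vertex G → Set
  Coloured p u = ∃ λ x → p u ≡ just x

  module Greedy {d} (N : ∀ x → Neighbours x d) where

    colour-vertex : ∀ (p : PartialColouring (suc d)) → ProperPartial p → ∀ u →
      Σ (PartialColouring (suc d)) λ q → ProperPartial q × p ⊑ q × Coloured q u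
    colour-vertex p proper u with p u in pu
    ... | just x = p , proper , (λ eq → eq) , x , pu
    ... | nothing = q , proper′ , extends , x , updateAt-updates u p
      where
      open ≡-Reasoning
      free : ∃ λ x → ∀ t → p (nbr (N u) t) ≢ just x
      free = missed-value (p ∘ nbr (N u))
      x : Fin (suc d)
      x = proj₁ free
      q : PartialColouring (suc d)
      q = updateAt p u (λ _ → just x)
      q-elsewhere : ∀ {w} → w ≢ u → q w ≡ p w
      q-elsewhere {w} w≢u = updateAt-minimal w u p w≢u
      extends : p ⊑ q
      extends {w} pw = trans (q-elsewhere w≢u) pw
        where
        w≢u : w ≢ u
        w≢u refl with trans (sym pu) pw
        ... | ()
      near-u : ∀ {w y} → Adj G u w → q u ≡ just y → q w ≢ just y
      near-u {w} {y} u~w qu qw with nbr-surjective (N u) u~w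
      ... | t , refl = proj₂ free t (begin
        p (nbr (N u) t) ≡⟨ sym (q-elsewhere (adj⇒≢ u~w ∘ sym)) ⟩
        q (nbr (N u) t) ≡⟨ qw ⟩
        just y          ≡⟨ sym qu ⟩
        q u             ≡⟨ updateAt-updates u p ⟩
        just x          ∎)
      proper′ : ProperPartial q
      proper′ {w₁} {w₂} w₁~w₂ q₁ q₂ with w₁ ≟ u | w₂ ≟ u
      ... | yes refl | _ = near-u w₁~w₂ q₁ q₂
      ... | no _ | yes refl = near-u (adj-sym w₁~w₂) q₂ q₁
      ... | no w₁≢u | no w₂≢u =
        proper w₁~w₂ (trans (sym (q-elsewhere w₁≢u)) q₁) (trans (sym (q-elsewhere w₂≢u)) q₂)

    colour-all : ∀ us (p : PartialColouring (suc d)) → ProperPartial p →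
      Σ (PartialColouring (suc d)) λ q → ProperPartial q × p ⊑ q × All (Coloured q) us
    colour-all [] p proper = p , proper , (λ eq → eq) , []
    colour-all (u ∷ us) p proper with colour-vertex p proper u
    ... | q , q-proper , p⊑q , (x , qu) with colour-all us q q-proper
    ... | r , r-proper , q⊑r , coloured = r , r-proper , p⊑r , (x , q⊑r qu) ∷ coloured
      where
      p⊑r : p ⊑ r
      p⊑r = q⊑r ∘ p⊑q

    extend : ∀ (p : PartialColouring (suc d)) → ProperPartial p →
      Σ (Vertex G → Fin (suc d)) λ c → Proper G (suc d) c × (∀ {u x} → p u ≡ just x → c u ≡ x)
    extend p proper with colour-all (allFin (n G)) p proper
    ... | q , q-proper , p⊑q , coloured = c , c-proper , λ pu → just-injective (trans (sym (qc _)) (p⊑q pu))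
      where
      c : Vertex G → Fin (suc d)
      c u = proj₁ (All.lookup coloured (∈-allFin u))
      qc : ∀ u → q u ≡ just (c u)
      qc u = proj₂ (All.lookup coloured (∈-allFin u))
      c-proper : Proper G (suc d) c
      c-proper u w u~w eq = q-proper u~w (qc u) (trans (qc w) (cong just (sym eq)))

  dominant-bound : ∀ {d k u} (c : Vertex G → Fin k) → Neighbours u d → Dominant G k c u → k ≤ suc d
  dominant-bound {d} {k} {u} c N dominant =
    injective⇒≤ {f = λ j → seen-at (dominant j)} λ {j} {j′} → seen-at-injective (dominant j) (dominant j′)
    where
    Seen : Fin k → Set
    Seen j = (c u ≡ j) ⊎ (∃ λ w → Adj G u w × c w ≡ j)
    seen-at : ∀ {j} → Seen j → Fin (suc d)
    seen-at (inj₁ _) = zero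
    seen-at (inj₂ (w , u~w , _)) = suc (proj₁ (nbr-surjective N u~w))
    seen-at-injective : ∀ {j j′} (s : Seen j) (s′ : Seen j′) → seen-at s ≡ seen-at s′ → j ≡ j′
    seen-at-injective (inj₁ refl) (inj₁ refl) _ = refl
    seen-at-injective (inj₂ (w , u~w , refl)) (inj₂ (w′ , u~w′ , refl)) eq = cong c (begin
      w                                      ≡⟨ sym (proj₂ (nbr-surjective N u~w)) ⟩
      nbr N (proj₁ (nbr-surjective N u~w))   ≡⟨ cong (nbr N) (suc-injective eq) ⟩
      nbr N (proj₁ (nbr-surjective N u~w′))  ≡⟨ proj₂ (nbr-surjective N u~w′) ⟩
      w′                                     ∎)
      where open ≡-Reasoning
    seen-at-injective (inj₁ _) (inj₂ _) ()
    seen-at-injective (inj₂ _) (inj₁ _) ()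

  b-colouring-bound : ∀ {d k} → (∀ x → Neighbours x d) → HasBColoring G k → k ≤ suc d
  b-colouring-bound {k = zero} _ _ = z≤n
  b-colouring-bound {k = suc k} N (c , _ , b-vertices) with b-vertices zero
  ... | u , _ , dominant = dominant-bound c (N u) dominant

module SecondNeighbourhood (G : Graph) {e : ℕ} (N : ∀ x → GraphColouring.Neighbours G x (suc e))
  (short-cycle-free : ∀ k → k < 5 → ¬ HasCycle G k) (v : Vertex G) (v-off-hexagons : ¬ OnCycle G v 6) where

  open GraphColouring G

  triangle-free : ∀ {a b c} → Adj G a b → Adj G b c → Adj G c a → ⊥
  triangle-free {a} {b} {c} ab bc ca = short-cycle-free 3 (s≤s (s≤s (s≤s (s≤s z≤n))))
    ( lookup (a ∷ b ∷ c ∷ [])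
    , s≤s (s≤s z≤n)
    , lookup-injective ((adj⇒≢ ab ∷ adj⇒≢ ca ∘ sym ∷ []) ∷ (adj⇒≢ bc ∷ []) ∷ [] ∷ [])
    , (λ { 0F → ab ; 1F → bc })
    , ca )

  square-free : ∀ {a b c d} → Adj G a b → Adj G b c → Adj G c d → Adj G d a → a ≢ c → b ≢ d → ⊥
  square-free {a} {b} {c} {d} ab bc cd da a≢c b≢d = short-cycle-free 4 (s≤s (s≤s (s≤s (s≤s (s≤s z≤n)))))
    ( lookup (a ∷ b ∷ c ∷ d ∷ [])
    , s≤s (s≤s z≤n)
    , lookup-injective
        ((adj⇒≢ ab ∷ a≢c ∷ adj⇒≢ da ∘ sym ∷ []) ∷ (adj⇒≢ bc ∷ b≢d ∷ []) ∷ (adj⇒≢ cd ∷ []) ∷ [] ∷ [])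
    , (λ { 0F → ab ; 1F → bc ; 2F → cd })
    , da )

  hexagon-free-at-v : ∀ {b c x y z} → Adj G v b → Adj G b c → Adj G c x → Adj G x y → Adj G y z → Adj G z v →
    v ≢ c → v ≢ x → v ≢ y → b ≢ x → b ≢ y → b ≢ z → c ≢ y → c ≢ z → x ≢ z → ⊥
  hexagon-free-at-v {b} {c} {x} {y} {z} vb bc cx xy yz zv v≢c v≢x v≢y b≢x b≢y b≢z c≢y c≢z x≢z =
    v-off-hexagons
    ( lookup (v ∷ b ∷ c ∷ x ∷ y ∷ z ∷ [])
    , ( s≤s (s≤s z≤n)
      , lookup-injective
          ( (adj⇒≢ vb ∷ v≢c ∷ v≢x ∷ v≢y ∷ adj⇒≢ zv ∘ sym ∷ [])
          ∷ (adj⇒≢ bc ∷ b≢x ∷ b≢y ∷ b≢z ∷ [])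
          ∷ (adj⇒≢ cx ∷ c≢y ∷ c≢z ∷ [])
          ∷ (adj⇒≢ xy ∷ x≢z ∷ [])
          ∷ (adj⇒≢ yz ∷ [])
          ∷ [] ∷ [])
      , (λ { 0F → vb ; 1F → bc ; 2F → cx ; 3F → xy ; 4F → yz })
      , zv )
    , zero , refl )

  first : Fin (suc e) → Vertex G
  first = nbr (N v)

  first-adj : ∀ i → Adj G v (first i)
  first-adj = nbr-adj (N v)

  back : Fin (suc e) → Fin (suc e)
  back i = proj₁ (nbr-surjective (N (first i)) (adj-sym (first-adj i)))

  back-to-v : ∀ i → nbr (N (first i)) (back i) ≡ v
  back-to-v i = proj₂ (nbr-surjective (N (first i)) (adj-sym (first-adj i)))

  -- The neighbours of first i other than v, indexed by skipping the index of v.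
  second : Slot e → Vertex G
  second (i , a) = nbr (N (first i)) (punchIn (back i) a)

  second-adj : ∀ i a → Adj G (first i) (second (i , a))
  second-adj i a = nbr-adj (N (first i)) (punchIn (back i) a)

  first-nonadjacent : ∀ i j → ¬ Adj G (first i) (first j)
  first-nonadjacent i j fi~fj with i ≟ j
  ... | yes refl = adj⇒≢ fi~fj refl
  ... | no _ = triangle-free (first-adj i) fi~fj (adj-sym (first-adj j))

  first≢first : ∀ {i j} → i ≢ j → first i ≢ first j
  first≢first i≢j = i≢j ∘ nbr-injective (N v)

  second≢v : ∀ i a → second (i , a) ≢ v
  second≢v i a eq = punchInᵢ≢i (back i) a (nbr-injective (N (first i)) (trans eq (sym (back-to-v i))))

  second≢first : ∀ i a j → second (i , a) ≢ first j
  second≢first i a j eq = first-nonadjacent i j (subst (Adj G (first i)) eq (second-adj i a))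

  first-second-nonadjacent : ∀ {i j} a → i ≢ j → ¬ Adj G (first j) (second (i , a))
  first-second-nonadjacent {i} {j} a i≢j fj~s =
    square-free (first-adj i) (second-adj i a) (adj-sym fj~s) (adj-sym (first-adj j))
      (second≢v i a ∘ sym) (first≢first i≢j)

  second-injective : Injective _≡_ _≡_ second
  second-injective {i , a} {j , b} eq with i ≟ j
  ... | yes refl = cong (i ,_) (punchIn-injective (back i) a b (nbr-injective (N (first i)) eq))
  ... | no i≢j = ⊥-elim (first-second-nonadjacent a i≢j (subst (Adj G (first j)) (sym eq) (second-adj j b)))

  second-adj⇒groups≢ : ∀ {i j a b} → Adj G (second (i , a)) (second (j , b)) → i ≢ j
  second-adj⇒groups≢ {i} {a = a} {b} s~t refl = triangle-free (second-adj i a) s~t (adj-sym (second-adj i b))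

  -- Two second neighbours with a common second neighbour close a 4-cycle (same group)
  -- or a 6-cycle through v (different groups).
  second-matching : ∀ {s t u} → Adj G (second s) (second u) → Adj G (second t) (second u) → s ≡ t
  second-matching {i , a} {j , b} {k , c} s~u t~u with i ≟ j
  ... | no i≢j = ⊥-elim (hexagon-free-at-v (first-adj i) (second-adj i a) s~u (adj-sym t~u)
      (adj-sym (second-adj j b)) (adj-sym (first-adj j))
      (second≢v i a ∘ sym) (second≢v k c ∘ sym) (second≢v j b ∘ sym)
      (second≢first k c i ∘ sym) (second≢first j b i ∘ sym) (first≢first i≢j)
      (i≢j ∘ cong proj₁ ∘ second-injective) (second≢first i a j) (second≢first k c j))
  ... | yes refl with a ≟ b
  ...   | yes refl = refl
  ...   | no a≢b = ⊥-elim (square-free (second-adj i a) s~u (adj-sym t~u) (adj-sym (second-adj i b))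
      (second≢first k c i ∘ sym) (a≢b ∘ cong proj₂ ∘ second-injective))

  open SlotColouring (λ s t → Adj G (second s) (second t)) (λ s t → T? (adj G (second s) (second t)))
    adj-sym second-adj⇒groups≢ second-matching

  σ : Assignment
  σ = proj₁ slot-colouring

  data Ball : Set where
    centre : Ball
    inner : Fin (suc e) → Ball
    outer : Slot e → Ball

  vertex : Ball → Vertex G
  vertex centre = v
  vertex (inner i) = first i
  vertex (outer s) = second s

  ball-colour : Ball → Fin (suc (suc e))
  ball-colour centre = zero
  ball-colour (inner i) = suc i
  ball-colour (outer s) = suc (colour σ s)

  vertex-injective : Injective _≡_ _≡_ vertex
  vertex-injective {centre} {centre} _ = refl
  vertex-injective {centre} {inner i} eq = ⊥-elim (adj⇒≢ (first-adj i) eq)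
  vertex-injective {centre} {outer (i , a)} eq = ⊥-elim (second≢v i a (sym eq))
  vertex-injective {inner i} {centre} eq = ⊥-elim (adj⇒≢ (first-adj i) (sym eq))
  vertex-injective {inner i} {inner j} eq = cong inner (nbr-injective (N v) eq)
  vertex-injective {inner j} {outer (i , a)} eq = ⊥-elim (second≢first i a j (sym eq))
  vertex-injective {outer (i , a)} {centre} eq = ⊥-elim (second≢v i a eq)
  vertex-injective {outer (i , a)} {inner j} eq = ⊥-elim (second≢first i a j eq)
  vertex-injective {outer s} {outer t} eq = cong outer (second-injective eq)

  inner-outer-colours : ∀ {i} s → Adj G (first i) (second s) → i ≢ colour σ s
  inner-outer-colours {i} (j , a) fi~s with j ≟ i
  ... | yes refl = colour≢group σ j a ∘ sym
  ... | no j≢i = ⊥-elim (first-second-nonadjacent a j≢i fi~s)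

  ball-colouring-proper : ∀ {r s} → Adj G (vertex r) (vertex s) → ball-colour r ≢ ball-colour s
  ball-colouring-proper {centre} {centre} r~s = ⊥-elim (adj⇒≢ r~s refl)
  ball-colouring-proper {centre} {inner _} _ ()
  ball-colouring-proper {centre} {outer _} _ ()
  ball-colouring-proper {inner _} {centre} _ ()
  ball-colouring-proper {inner i} {inner j} r~s = ⊥-elim (first-nonadjacent i j r~s)
  ball-colouring-proper {inner _} {outer t} r~s = inner-outer-colours t r~s ∘ suc-injective
  ball-colouring-proper {outer _} {centre} _ ()
  ball-colouring-proper {outer s} {inner _} r~s = inner-outer-colours s (adj-sym r~s) ∘ sym ∘ suc-injective
  ball-colouring-proper {outer _} {outer _} r~s = proj₂ slot-colouring r~s ∘ suc-injective

  locate : ∀ u → Dec (∃ λ r → vertex r ≡ u)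
  locate u with v ≟ u | any? (λ i → first i ≟ u) | any? (λ i → any? (λ a → second (i , a) ≟ u))
  ... | yes v≡u | _ | _ = yes (centre , v≡u)
  ... | no _ | yes (i , eq) | _ = yes (inner i , eq)
  ... | no _ | no _ | yes (i , a , eq) = yes (outer (i , a) , eq)
  ... | no v≢u | no ∉first | no ∉second = no λ
    { (centre , eq) → v≢u eq
    ; (inner i , eq) → ∉first (i , eq)
    ; (outer (i , a) , eq) → ∉second (i , a , eq) }

  precolouring : PartialColouring (suc (suc e))
  precolouring u with locate u
  ... | yes (r , _) = just (ball-colour r)
  ... | no _ = nothing

  precolouring-vertex : ∀ r → precolouring (vertex r) ≡ just (ball-colour r)
  precolouring-vertex r with locate (vertex r)
  ... | yes (r′ , eq) = cong (just ∘ ball-colour) (vertex-injective eq)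
  ... | no unlocated = ⊥-elim (unlocated (r , refl))

  precolouring-just : ∀ {u x} → precolouring u ≡ just x → ∃ λ r → vertex r ≡ u × ball-colour r ≡ x
  precolouring-just {u} eq with locate u
  ... | yes (r , vr≡u) = r , vr≡u , just-injective eq

  precolouring-proper : ProperPartial precolouring
  precolouring-proper u~w pu pw with precolouring-just pu | precolouring-just pw
  ... | r , refl , refl | s , refl , cs = ball-colouring-proper u~w (sym cs)

  colouring : Σ (Vertex G → Fin (suc (suc e))) λ c →
    Proper G (suc (suc e)) c × (∀ {u x} → precolouring u ≡ just x → c u ≡ x)
  colouring = Greedy.extend N precolouring precolouring-proper

  c : Vertex G → Fin (suc (suc e))
  c = proj₁ colouring

  c-ball : ∀ r → c (vertex r) ≡ ball-colour r
  c-ball r = proj₂ (proj₂ colouring) (precolouring-vertex r)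

  centre-dominant : Dominant G (suc (suc e)) c v
  centre-dominant zero = inj₁ (c-ball centre)
  centre-dominant (suc i) = inj₂ (first i , first-adj i , c-ball (inner i))

  inner-dominant : ∀ i → Dominant G (suc (suc e)) c (first i)
  inner-dominant i zero = inj₂ (v , adj-sym (first-adj i) , c-ball centre)
  inner-dominant i (suc j) with i ≟ j
  ... | yes refl = inj₁ (c-ball (inner i))
  ... | no i≢j = inj₂ (second (i , a) , second-adj i a , trans (c-ball (outer (i , a))) (cong suc colour≡j))
    where
    open ≡-Reasoning
    a : Fin e
    a = σ i ⟨$⟩ˡ punchOut i≢j
    colour≡j : colour σ (i , a) ≡ j
    colour≡j = begin
      punchIn i (σ i ⟨$⟩ʳ (σ i ⟨$⟩ˡ punchOut i≢j)) ≡⟨ cong (punchIn i) (inverseʳ (σ i)) ⟩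
      punchIn i (punchOut i≢j)                      ≡⟨ punchIn-punchOut i≢j ⟩
      j                                             ∎

  b-colouring : IsBColoring G (suc (suc e)) c
  b-colouring = proj₁ (proj₂ colouring) , λ
    { zero → v , c-ball centre , centre-dominant
    ; (suc i) → first i , c-ball (inner i) , inner-dominant i }

theorem7 : (d : ℕ) → 7 ≤ d → (G : Graph) → Regular d G → Girth G 5 →
    (∃ λ (v : Vertex G) → ¬ OnCycle G v 6) → BChromatic G (suc d)
theorem7 (suc e) (s≤s _) G regular (_ , short-cycle-free) (v , v-off-hexagons) =
  (c , b-colouring) , λ _ → b-colouring-bound N
  where
  open GraphColouring G using (Neighbours; neighbours; b-colouring-bound)
  N : ∀ x → Neighbours x (suc e)
  N x = neighbours x (regular x)
  open SecondNeighbourhood G N short-cycle-free v v-off-hexagons using (c; b-colouring)
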